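{- Every positive integer is a $1$-power factoradic happy number, i.e. for every $n\in\mathbb{Z}^+$ there exists $\ell\in\mathbb{Z}^+$ with $S_{1,!}^{\ell}(n)=1$.
   Context: Every positive integer $n$ has a unique factorial base representation $n=\sum_{i=1}^k a_i\cdot i!$ with $a_k\neq 0$ and $0\leq a_i\leq i$ for $1\leq i\leq k$. Define $S_{1,!}(n)=\sum_{i=1}^k a_i$ for $n\geq 1$ and $S_{1,!}(0)=0$; $S_{1,!}^{\ell}$ denotes the $\ell$-th iterate. -}

module Defs where

open import Data.Nat using (ℕ; zero; suc; _+_; _*_)
open import Data.Nat.DivMod using (_/_; _%_)
open import Data.List using (List; []; _∷_)
open import Data.Nat.ListAction using (sum)

-- Factorial base digits of m, starting at position i-1 with radix b = i+1:
-- digit a_i = (m / i!) mod (i+1). Computed by repeated division: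
-- a_1 = m mod 2, then m' = m / 2, a_2 = m' mod 3, m'' = m' / 3, etc.
-- The first argument is fuel (m is always enough, since the radix is ≥ 2,
-- so the quotient strictly decreases and reaches 0 within m steps).
facDigitsFrom : ℕ → ℕ → ℕ → List ℕ
facDigitsFrom zero    b m = []
facDigitsFrom (suc f) b zero = []
facDigitsFrom (suc f) b (suc m) =
  (suc m % suc (suc b)) ∷ facDigitsFrom f (suc b) (suc m / suc (suc b))

-- Factorial base digits [a_1, a_2, ..., a_k] of n (empty for n = 0),
-- where n = Σ a_i · i!, 0 ≤ a_i ≤ i.
facDigits : ℕ → List ℕ
facDigits n = facDigitsFrom n 0 n

S1! : ℕ → ℕ
S1! n = sum (facDigits n)

iter : ℕ → (ℕ → ℕ) → ℕ → ℕ
iter zero    f x = x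
iter (suc l) f x = f (iter l f x)

{-# OPTIONS --safe #-}
-- Taking a digit sum never increases a number, and strictly decreases it as soon as
-- there is a second digit, since a unit in position i ≥ 2 is worth i! > 1. It also
-- never reaches 0 from a positive number. So starting from n ≥ 1 the iterates of S1!
-- strictly decrease while they are ≥ 2 and stay positive, hence they reach 1, a
-- fixed point.
module Submission where

open import Defs
open import Data.Nat using (ℕ; zero; suc; _+_; _*_; _≤_; _<_; z≤n; s≤s; s≤s⁻¹; >-nonZero)
open import Data.Nat.Properties
open import Data.Nat.DivMod using (_/_; _%_; m≡m%n+[m/n]*n; m/n<m; m≥n⇒m/n>0; m<n⇒m%n≡m; m/n≡0⇒m<n)
open import Data.Nat.ListAction using (sum)
open import Data.Nat.Induction using (<-rec)
open import Data.Product using (∃; _,_)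
open import Relation.Binary.PropositionalEquality

sum-facDigitsFrom-≤ : ∀ f b m → sum (facDigitsFrom f b m) ≤ m
sum-facDigitsFrom-≤ zero    b m       = z≤n
sum-facDigitsFrom-≤ (suc f) b zero    = z≤n
sum-facDigitsFrom-≤ (suc f) b (suc m) = begin
  suc m % q + sum (facDigitsFrom f (suc b) (suc m / q))
    ≤⟨ +-monoʳ-≤ (suc m % q) (sum-facDigitsFrom-≤ f (suc b) (suc m / q)) ⟩
  suc m % q + suc m / q
    ≤⟨ +-monoʳ-≤ (suc m % q) (m≤m*n (suc m / q) q) ⟩
  suc m % q + suc m / q * q
    ≡⟨ m≡m%n+[m/n]*n (suc m) q ⟨
  suc m ∎
  where open ≤-Reasoning
        q = suc (suc b)

sum-facDigitsFrom-< : ∀ f b {m} → suc (suc b) ≤ m → sum (facDigitsFrom (suc f) b m) < m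
sum-facDigitsFrom-< f b {m@(suc _)} q≤m = begin-strict
  m % q + sum (facDigitsFrom f (suc b) (m / q))
    ≤⟨ +-monoʳ-≤ (m % q) (sum-facDigitsFrom-≤ f (suc b) (m / q)) ⟩
  m % q + m / q
    <⟨ +-monoʳ-< (m % q) (m<m*n (m / q) q {{>-nonZero quotient>0}} (s≤s (s≤s z≤n))) ⟩
  m % q + m / q * q
    ≡⟨ m≡m%n+[m/n]*n m q ⟨
  m ∎
  where open ≤-Reasoning
        q = suc (suc b)
        quotient>0 : 0 < m / q
        quotient>0 = m≥n⇒m/n>0 q≤m

-- The fuel bound m < f matters: with too little fuel the digit list is cut off early.
sum-facDigitsFrom-pos : ∀ f b m → m < f → 0 < sum (facDigitsFrom f b (suc m))
sum-facDigitsFrom-pos (suc f) b m (s≤s m≤f) with suc m / suc (suc b) in quotient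
... | zero = ≤-trans leading-digit-pos (m≤m+n (suc m % q) _)
  where
    q = suc (suc b)
    leading-digit-pos : 0 < suc m % q
    leading-digit-pos = subst (0 <_) (sym (m<n⇒m%n≡m {q} {suc m} (m/n≡0⇒m<n quotient))) (s≤s z≤n)
... | suc d = ≤-trans (sum-facDigitsFrom-pos f (suc b) d d<f) (m≤n+m _ (suc m % q))
  where
    q = suc (suc b)
    d<f : d < f
    d<f = ≤-trans (s≤s⁻¹ (subst (_< suc m) quotient (m/n<m (suc m) q (s≤s (s≤s z≤n))))) m≤f

S1!-< : ∀ {n} → 2 ≤ n → S1! n < n
S1!-< {n@(suc k)} 2≤n = sum-facDigitsFrom-< k 0 2≤n

S1!-pos : ∀ n → 0 < S1! (suc n)
S1!-pos n = sum-facDigitsFrom-pos (suc n) 0 n ≤-refl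

iter-suc′ : ∀ l (f : ℕ → ℕ) x → iter (suc l) f x ≡ iter l f (f x)
iter-suc′ zero    f x = refl
iter-suc′ (suc l) f x = cong f (iter-suc′ l f x)

iterate-reaches-1 : (f : ℕ → ℕ) → f 1 ≡ 1 → (∀ n → 0 < f (suc n)) → (∀ {n} → 2 ≤ n → f n < n) →
                    (n : ℕ) → ∃ λ ℓ → iter (suc ℓ) f (suc n) ≡ 1
iterate-reaches-1 f f1≡1 pos decr = <-rec _ step
  where
    step : ∀ n → (∀ {k} → k < n → ∃ λ ℓ → iter (suc ℓ) f (suc k) ≡ 1) →
           ∃ λ ℓ → iter (suc ℓ) f (suc n) ≡ 1
    step zero    _  = 0 , f1≡1
    step (suc k) ih with f (suc (suc k)) in image | pos (suc k) | decr {suc (suc k)} (s≤s (s≤s z≤n))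
    ... | zero  | () | _
    ... | suc j | _  | s≤s j<suc-k with ih j<suc-k
    ...   | ℓ , reaches = suc ℓ , (begin
      iter (suc (suc ℓ)) f (suc (suc k)) ≡⟨ iter-suc′ (suc ℓ) f (suc (suc k)) ⟩
      iter (suc ℓ) f (f (suc (suc k)))   ≡⟨ cong (iter (suc ℓ) f) image ⟩
      iter (suc ℓ) f (suc j)             ≡⟨ reaches ⟩
      1                                  ∎)
      where open ≡-Reasoning

corollary2p4 : (n : ℕ) → ∃ λ ℓ → iter (suc ℓ) S1! (suc n) ≡ 1
corollary2p4 = iterate-reaches-1 S1! refl S1!-pos S1!-<
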